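{- In the setting described in the context, suppose $2\mid N$ (recall $N\mid C$). Then (a) $u$ and $u'$ are odd and $\theta\equiv(N-1)vu'\left(\frac{C}{Np}-A\right)\pmod 4$; (b) if moreover $4\mid C$, then $2\mid vB$.
   Context: Setting: Let $N>1$ be an integer, $N=2^{\lambda(N)}N_1$ with $N_1$ odd. Let $D=c^2\Delta<0$ be a discriminant with fundamental part $\Delta$ and conductor $c$, $K=\mathbb Q(\sqrt D)$, $\mathcal O$ the order of discriminant $D$. Let $[A,B,C]$ be a primitive positive definite integral quadratic form with $B^2-4AC=D$, $\gcd(A,N)=1$ and $N\mid C$. Let $\alpha=\frac{ -B+\sqrt D}{2A}$, so $\mathcal O=\mathbb Z+\mathbb Z A\alpha$. Let $u,v\in\mathbb Z$ be such that $\pi=u+vA\alpha$ has norm $p=u^2-uvB+v^2AC$ a prime number not dividing $6cN$ that splits in $\mathcal O$, and assume $p\mid C$ and $p\mid u$. Set $u'=u-vB$. Let $v_1$, $A_1$ be the odd parts of $v$, $A$ ($v_1=1$ if $v=0$). Define the integer $\theta=(N-1)v\left(u'\frac{C}{Np}+A\left(\frac up(1-u'^2)-u'\right)\right)+3v_1A_1(N_1-1)(u'-1)+\frac{3\lambda(N)(u'^2-1)}{2}.$ -}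

module Defs where

open import Data.Nat as ℕ using (ℕ; zero; suc)
open import Data.Integer using (ℤ; +_; _+_; _-_; _*_; -_; ∣_∣)
open import Data.Integer.DivMod using (_/ℕ_)
open import Data.Integer.Divisibility using (_∣_)
open import Data.Nat.Divisibility as ND using ()
open import Data.Product using (Σ; _×_; ∃)
open import Data.Sum using (_⊎_)
open import Relation.Binary.PropositionalEquality using (_≡_)
open import Relation.Nullary using (¬_)

-- Division of an integer by a natural number, used only where the paper's
-- division is exact (then it is the exact quotient).  Division by 0 returns 0.
exDiv : ℤ → ℕ → ℤ
exDiv a zero    = + 0
exDiv a (suc k) = a /ℕ suc k

SquareFree : ℤ → Set
SquareFree m = ∀ (d : ℕ) → (d ℕ.* d) ND.∣ ∣ m ∣ → d ≡ 1

IsFundamental : ℤ → Set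
IsFundamental Δ =
  ((+ 4 ∣ (Δ - + 1)) × SquareFree Δ)
  ⊎ (Σ ℤ λ m → (Δ ≡ + 4 * m) × ((+ 4 ∣ (m - + 2)) ⊎ (+ 4 ∣ (m - + 3))) × SquareFree m)

-- An (odd) prime p splits in the quadratic order of discriminant D
-- (for p not dividing the conductor): D is a nonzero square modulo p.
SplitsIn : ℕ → ℤ → Set
SplitsIn p D = ¬ (+ p ∣ D) × ∃ λ (x : ℤ) → + p ∣ (x * x - D)

OddPartℕ : ℕ → ℕ → Set
OddPartℕ x x₁ = Σ ℕ λ k → (x ≡ 2 ℕ.^ k ℕ.* x₁) × ¬ (2 ND.∣ x₁)

-- odd part of an integer, with the convention odd part of 0 is 1
OddPartℤ : ℤ → ℤ → Set
OddPartℤ x x₁ = ((x ≡ + 0) × (x₁ ≡ + 1))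
  ⊎ (Σ ℕ λ k → (x ≡ + (2 ℕ.^ k) * x₁) × ¬ (+ 2 ∣ x₁))

theta : (N p lam N₁ : ℕ) (A B C u v v₁ A₁ : ℤ) → ℤ
theta N p lam N₁ A B C u v v₁ A₁ =
  let u' = u - v * B in
  (+ N - + 1) * v * (u' * exDiv C (N ℕ.* p) + A * (exDiv u p * (+ 1 - u' * u') - u'))
  + + 3 * v₁ * A₁ * (+ N₁ - + 1) * (u' - + 1)
  + exDiv (+ 3 * + lam * (u' * u' - + 1)) 2

{-# OPTIONS --safe #-}
module Submission where

-- Since p ∤ 6cN, p is odd, while 2 ∣ N ∣ C.  Reading the norm as
-- p = u u' + v² A C shows that u u' is odd, so u and u' are odd, and vB = u − u'
-- is even.  Modulo 4, θ differs from (N−1) v u' (C/(Np) − A) by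
-- −(N−1) v A (u/p) (u'² − 1) + 3 v₁ A₁ (N₁ − 1)(u' − 1) + 3 λ(N) (u'² − 1)/2,
-- and each term vanishes mod 4 because u' and N₁ are odd and an odd square is
-- 1 mod 8.

open import Defs
open import Data.Nat as ℕ using (ℕ)
open import Data.Integer using (ℤ; +_; _+_; _-_; _*_; _<_; _>_; _/ℕ_; _%ℕ_)
open import Data.Integer.Divisibility using (_∣_)
open import Data.Integer.Divisibility.Signed as S
  using (divides; ∣ᵤ⇒∣; ∣⇒∣ᵤ; _∣?_; ∣m∣n⇒∣m+n; ∣m∣n⇒∣m-n; ∣m+n∣n⇒∣m; ∣n⇒∣m*n; ∣m⇒∣m*n)
open import Data.Integer.DivMod using (a≡a%ℕn+[a/ℕn]*n; n%ℕd<d)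
open import Data.Integer.GCD using (gcd)
open import Data.Integer.Properties using (+-identityˡ; *-cancelʳ-≡; *-assoc)
open import Data.Integer.Tactic.RingSolver using (solve-∀)
open import Data.Nat.Divisibility as ND using ()
open import Data.Nat.Primality using (Prime; prime⇒irreducible)
open import Data.Product using (_×_; _,_; proj₁; proj₂)
open import Data.Sum using (inj₁; inj₂)
open import Data.Empty using (⊥-elim)
open import Function using (_∘_)
open import Relation.Binary.PropositionalEquality using (_≡_; refl; sym; trans; cong; subst; module ≡-Reasoning)
open import Relation.Nullary using (¬_; yes; no)

prime∤even⇒odd : ∀ {p m} → Prime p → 2 ND.∣ m → ¬ (p ND.∣ m) → ¬ (2 ND.∣ p)
prime∤even⇒odd p-prime 2∣m p∤m 2∣p with prime⇒irreducible p-prime 2∣p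
... | inj₁ ()
... | inj₂ refl = p∤m 2∣m

2∤1 : ¬ (+ 2 S.∣ + 1)
2∤1 2∣1 with ND.∣1⇒≡1 (∣⇒∣ᵤ 2∣1)
... | ()

odd⇒2∣pred : ∀ {x} → ¬ (+ 2 S.∣ x) → + 2 S.∣ x - + 1
odd⇒2∣pred {x} 2∤x with x %ℕ 2 | a≡a%ℕn+[a/ℕn]*n x 2 | n%ℕd<d x 2
... | 0 | x≡2q | _ = ⊥-elim (2∤x (divides (x /ℕ 2) (trans x≡2q (+-identityˡ _))))
... | 1 | x≡2q+1 | _ = divides (x /ℕ 2) (trans (cong (_- + 1) x≡2q+1) (cancel-one (x /ℕ 2)))
  where
  cancel-one : ∀ q → + 1 + q * + 2 - + 1 ≡ q * + 2
  cancel-one = solve-∀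
... | ℕ.suc (ℕ.suc _) | _ | ℕ.s≤s (ℕ.s≤s ())

*-pres-∣ : ∀ {i j m n} → i S.∣ m → j S.∣ n → i * j S.∣ m * n
*-pres-∣ {i} {j} (divides q refl) (divides r refl) = divides (q * r) (regroup q i r j)
  where
  regroup : ∀ q i r j → q * i * (r * j) ≡ q * r * (i * j)
  regroup = solve-∀

2∣k*[k+1] : ∀ k → + 2 S.∣ k * (k + + 1)
2∣k*[k+1] k with + 2 ∣? k
... | yes 2∣k = ∣m⇒∣m*n (k + + 1) 2∣k
... | no  2∤k =
  ∣n⇒∣m*n k (subst (+ 2 S.∣_) (shift k) (∣m∣n⇒∣m+n (odd⇒2∣pred 2∤k) (divides (+ 1) refl)))
  where
  shift : ∀ k → k - + 1 + + 2 ≡ k + + 1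
  shift = solve-∀

8∣odd²-1 : ∀ {x} → + 2 S.∣ x - + 1 → + 8 S.∣ x * x - + 1
8∣odd²-1 {x} (divides k x-1≡2k) with 2∣k*[k+1] k
... | divides j k[k+1]≡2j = divides j (begin
  x * x - + 1                   ≡⟨ around-one x ⟩
  (x - + 1) * (x - + 1 + + 2)   ≡⟨ cong (λ y → y * (y + + 2)) x-1≡2k ⟩
  k * + 2 * (k * + 2 + + 2)     ≡⟨ factor k ⟩
  k * (k + + 1) * + 4           ≡⟨ cong (_* + 4) k[k+1]≡2j ⟩
  j * + 2 * + 4                 ≡⟨ *-assoc j (+ 2) (+ 4) ⟩
  j * + 8                       ∎)
  where
  open ≡-Reasoning
  around-one : ∀ x → x * x - + 1 ≡ (x - + 1) * (x - + 1 + + 2)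
  around-one = solve-∀
  factor : ∀ k → k * + 2 * (k * + 2 + + 2) ≡ k * (k + + 1) * + 4
  factor = solve-∀

m*2/ℕ2≡m : ∀ x → (x * + 2) /ℕ 2 ≡ x
m*2/ℕ2≡m x with (x * + 2) %ℕ 2 | a≡a%ℕn+[a/ℕn]*n (x * + 2) 2 | n%ℕd<d (x * + 2) 2
... | 0 | 2x≡2q | _ = *-cancelʳ-≡ _ x (+ 2) (sym (trans 2x≡2q (+-identityˡ _)))
... | 1 | 2x≡2q+1 | _ =
  ⊥-elim (2∤1 (∣m+n∣n⇒∣m (subst (+ 2 S.∣_) 2x≡2q+1 (divides x refl)) (divides ((x * + 2) /ℕ 2) refl)))
... | ℕ.suc (ℕ.suc _) | _ | ℕ.s≤s (ℕ.s≤s ())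

8∣y⇒4∣y/2 : ∀ {y} → + 8 S.∣ y → + 4 S.∣ exDiv y 2
8∣y⇒4∣y/2 (divides m refl) =
  divides m (trans (cong (_/ℕ 2) (sym (*-assoc m (+ 4) (+ 2)))) (m*2/ℕ2≡m (m * + 4)))

odd-norm⇒odd-factors : ∀ {n u u' w} → n ≡ u * u' + w → + 2 S.∣ w → ¬ (+ 2 S.∣ n) →
                       ¬ (+ 2 S.∣ u) × ¬ (+ 2 S.∣ u')
odd-norm⇒odd-factors {u = u} {u'} n≡uu'+w 2∣w 2∤n =
  (λ 2∣u → 2∤uu' (∣m⇒∣m*n u' 2∣u)) , (λ 2∣u' → 2∤uu' (∣n⇒∣m*n u 2∣u'))
  where
  2∤uu' : ¬ (+ 2 S.∣ u * u')
  2∤uu' 2∣uu' = 2∤n (subst (+ 2 S.∣_) (sym n≡uu'+w) (∣m∣n⇒∣m+n 2∣uu' 2∣w))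

theta-shifted≡ : ∀ m v X A Y v₁ A₁ n₁ u' h →
  m * v * (u' * X + A * (Y * (+ 1 - u' * u') - u')) + + 3 * v₁ * A₁ * (n₁ - + 1) * (u' - + 1) + h
    - m * v * u' * (X - A)
  ≡ + 3 * v₁ * A₁ * ((n₁ - + 1) * (u' - + 1)) + h - m * v * A * Y * (u' * u' - + 1)
theta-shifted≡ = solve-∀

theta-congruence : ∀ N p lam N₁ A B C u v v₁ A₁ → ¬ (+ 2 S.∣ + N₁) → ¬ (+ 2 S.∣ u - v * B) →
  + 4 S.∣ theta N p lam N₁ A B C u v v₁ A₁ - (+ N - + 1) * v * (u - v * B) * (exDiv C (N ℕ.* p) - A)
theta-congruence N p lam N₁ A B C u v v₁ A₁ N₁-odd u'-odd =
  subst (+ 4 S.∣_)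
        (sym (theta-shifted≡ (+ N - + 1) v (exDiv C (N ℕ.* p)) A (exDiv u p) v₁ A₁ (+ N₁) u' halved))
        (∣m∣n⇒∣m-n (∣m∣n⇒∣m+n 4∣odd-part-term 4∣halved) 4∣norm-term)
  where
  u' : ℤ
  u' = u - v * B
  halved : ℤ
  halved = exDiv (+ 3 * + lam * (u' * u' - + 1)) 2
  2∣u'-1 : + 2 S.∣ u' - + 1
  2∣u'-1 = odd⇒2∣pred u'-odd
  8∣u'²-1 : + 8 S.∣ u' * u' - + 1
  8∣u'²-1 = 8∣odd²-1 {u'} 2∣u'-1
  4∣odd-part-term : + 4 S.∣ + 3 * v₁ * A₁ * ((+ N₁ - + 1) * (u' - + 1))
  4∣odd-part-term = ∣n⇒∣m*n (+ 3 * v₁ * A₁) (*-pres-∣ (odd⇒2∣pred N₁-odd) 2∣u'-1)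
  4∣halved : + 4 S.∣ halved
  4∣halved = 8∣y⇒4∣y/2 (∣n⇒∣m*n (+ 3 * + lam) 8∣u'²-1)
  4∣norm-term : + 4 S.∣ (+ N - + 1) * v * A * exDiv u p * (u' * u' - + 1)
  4∣norm-term = ∣n⇒∣m*n ((+ N - + 1) * v * A * exDiv u p) (S.∣-trans (divides (+ 2) refl) 8∣u'²-1)

norm-factored : ∀ u v B A C → u * u - u * v * B + v * v * A * C ≡ u * (u - v * B) + v * v * A * C
norm-factored = solve-∀

vB≡[u-1]-[u'-1] : ∀ u v B → v * B ≡ (u - + 1) - (u - v * B - + 1)
vB≡[u-1]-[u'-1] = solve-∀

mainTheorem7 : (N : ℕ) (lam N₁ : ℕ) (D Δ : ℤ) (c : ℕ) (A B C : ℤ) (u v : ℤ) (p : ℕ) (v₁ A₁ : ℤ) →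
    1 ℕ.< N →
    N ≡ 2 ℕ.^ lam ℕ.* N₁ → ¬ (2 ND.∣ N₁) →
    D < + 0 → IsFundamental Δ → 1 ℕ.≤ c → D ≡ + (c ℕ.* c) * Δ →
    A > + 0 → gcd (gcd A B) C ≡ + 1 → B * B - + 4 * A * C ≡ D →
    gcd A (+ N) ≡ + 1 → + N ∣ C →
    Prime p → + p ≡ u * u - u * v * B + v * v * A * C →
    ¬ (p ND.∣ 6 ℕ.* c ℕ.* N) → SplitsIn p D →
    + p ∣ C → + p ∣ u →
    OddPartℤ v v₁ → OddPartℤ A A₁ →
    2 ND.∣ N →
    (¬ (+ 2 ∣ u) × ¬ (+ 2 ∣ (u - v * B))
      × + 4 ∣ (theta N p lam N₁ A B C u v v₁ A₁
               - (+ N - + 1) * v * (u - v * B) * (exDiv C (N ℕ.* p) - A)))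
    × (+ 4 ∣ C → + 2 ∣ v * B)
mainTheorem7 N lam N₁ D Δ c A B C u v p v₁ A₁ _ _ N₁-odd _ _ _ _ _ _ _ _ N∣C
             p-prime p≡norm p∤6cN _ _ _ _ _ 2∣N =
  (u-odd ∘ ∣ᵤ⇒∣ , u'-odd ∘ ∣ᵤ⇒∣ , ∣⇒∣ᵤ (theta-congruence N p lam N₁ A B C u v v₁ A₁ (N₁-odd ∘ ∣⇒∣ᵤ) u'-odd))
  , λ _ → ∣⇒∣ᵤ vB-even
  where
  2∣6cN : 2 ND.∣ 6 ℕ.* c ℕ.* N
  2∣6cN = ND.∣-trans (ND.∣-trans (ND.divides 3 refl) (ND.m∣m*n c)) (ND.m∣m*n N)
  p-odd : ¬ (+ 2 S.∣ + p)
  p-odd = prime∤even⇒odd p-prime 2∣6cN p∤6cN ∘ ∣⇒∣ᵤ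
  2∣v²AC : + 2 S.∣ v * v * A * C
  2∣v²AC = ∣n⇒∣m*n (v * v * A) (∣ᵤ⇒∣ (ND.∣-trans 2∣N N∣C))
  u-odd×u'-odd : ¬ (+ 2 S.∣ u) × ¬ (+ 2 S.∣ u - v * B)
  u-odd×u'-odd = odd-norm⇒odd-factors (trans p≡norm (norm-factored u v B A C)) 2∣v²AC p-odd
  u-odd : ¬ (+ 2 S.∣ u)
  u-odd = proj₁ u-odd×u'-odd
  u'-odd : ¬ (+ 2 S.∣ u - v * B)
  u'-odd = proj₂ u-odd×u'-odd
  vB-even : + 2 S.∣ v * B
  vB-even = subst (+ 2 S.∣_) (sym (vB≡[u-1]-[u'-1] u v B))
                  (∣m∣n⇒∣m-n (odd⇒2∣pred u-odd) (odd⇒2∣pred u'-odd))
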